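{- For $n\ge 0$ let $s_n=\sigma(\mathfrak S_n)$ (with $s_0=1$). Then for $n\ge 2$, $$s_n=\sum_{1\le i\le\lfloor n/2\rfloor}\binom{n-1}{2i-1}s_{2i-1}s_{n-2i},$$ and for $n\ge 1$, $$s_n=\sum_{0\le i\le\lfloor (n-1)/2\rfloor}\binom{n-1}{2i}s_{2i}s_{n-2i-1}.$$
   Context: For a finite simple digraph $\mathfrak G=(V,A)$ with $|V|=n$, a disposition is a bijection $f:V\to\{1,\dots,n\}$ with $f(v_1)>f(v_2)$ whenever $(v_1,v_2)\in A$, and $\sigma(\mathfrak G)$ is the number of dispositions; the digraph with no vertices has counter $1$. For $n\in\mathbb N$, the staircase digraph $\mathfrak S_n$ has vertex set $\{v_1,\dots,v_n\}$ and arc set $\{(v_{2i+1},v_{2i+2}) : 0\le i\le\lfloor (n-2)/2\rfloor\}\cup\{(v_{2i-1},v_{2i-2}) : 2\le i\le\lfloor (n+1)/2\rfloor\}$ (so the arcs are $(v_1,v_2),(v_3,v_2),(v_3,v_4),(v_5,v_4),\dots$); $\mathfrak S_0$ is the digraph with no vertices. -}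

module Defs where

open import Data.Bool using (Bool; true; false; T; _∧_; _∨_)
open import Data.Nat using (ℕ; zero; suc; _+_; _*_; _∸_; _≡ᵇ_)
open import Data.Nat.Combinatorics using (_C_)
open import Data.Nat.DivMod using (_/_; _%_)
open import Data.Fin using (Fin; toℕ; _<?_) renaming (_<_ to _<ᶠ_)
open import Data.Fin.Properties using (_≟_)
open import Data.List using (List; []; _∷_; map; filter; length; upTo; allFin; concatMap)
open import Data.Vec using (Vec; lookup; toList) renaming ([] to []ᵥ; _∷_ to _∷ᵥ_)
open import Data.Nat.ListAction using (sum)
open import Data.List.Relation.Unary.All using (All)
import Data.List.Relation.Unary.All as All
open import Data.List.Relation.Unary.Unique.Propositional using (Unique)
import Data.List.Relation.Unary.Unique.DecPropositional as UDec
open import Data.Product using (_×_)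
open import Relation.Nullary using (Dec; yes; no)
open import Relation.Nullary.Decidable using (_×-dec_)
open import Relation.Unary using (Decidable)

-- A finite simple digraph on vertex set Fin n, with arc relation given as a
-- Boolean predicate (vertex v_k of the paper is the element k-1 of Fin n).
record Digraph : Set where
  field
    size : ℕ
    arc  : Fin size → Fin size → Bool

open Digraph public

allVecs : (k m : ℕ) → List (Vec (Fin k) m)
allVecs k zero    = []ᵥ ∷ []
allVecs k (suc m) = concatMap (λ x → map (x ∷ᵥ_) (allVecs k m)) (allFin k)

-- f : Fin n → Fin n (values 0..n-1 stand for 1..n) is a disposition of G:
-- f is a bijection (injective on the finite set Fin n, hence bijective) and
-- f v₁ > f v₂ for every arc (v₁ , v₂).
ArcsRespected : (G : Digraph) → Vec (Fin (size G)) (size G) → Set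
ArcsRespected G f =
  All (λ a → All (λ b → T (arc G a b) → lookup f b <ᶠ lookup f a) (allFin (size G)))
      (allFin (size G))

IsDisposition : (G : Digraph) → Vec (Fin (size G)) (size G) → Set
IsDisposition G f = Unique (toList f) × ArcsRespected G f

arcsRespected? : (G : Digraph) → Decidable (ArcsRespected G)
arcsRespected? G f =
  All.all? (λ a → All.all? (λ b → impl (arc G a b) a b) (allFin (size G))) (allFin (size G))
  where
  impl : (x : Bool) → (a b : Fin (size G)) → Dec (T x → lookup f b <ᶠ lookup f a)
  impl false a b = yes (λ ())
  impl true a b with lookup f b <? lookup f a
  ... | yes p = yes (λ _ → p)
  ... | no ¬p = no (λ h → ¬p (h _))

isDisposition? : (G : Digraph) → Decidable (IsDisposition G)
isDisposition? G f = UDec.unique? (_≟_ {size G}) (toList f) ×-dec arcsRespected? G f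

σ : Digraph → ℕ
σ G = length (filter (isDisposition? G) (allVecs (size G) (size G)))

-- With 0-based indices (v_k ↦ k-1) the arcs
-- (v_{2i+1}, v_{2i+2}) and (v_{2i-1}, v_{2i-2}) are exactly the pairs (a , b)
-- with a even and b = a + 1, or a even and b + 1 = a.
isEven : ℕ → Bool
isEven n = (n % 2) ≡ᵇ 0

stairArc : {n : ℕ} → Fin n → Fin n → Bool
stairArc a b = isEven (toℕ a) ∧ ((toℕ b ≡ᵇ suc (toℕ a)) ∨ (suc (toℕ b) ≡ᵇ toℕ a))

Staircase : ℕ → Digraph
Staircase n = record { size = n ; arc = stairArc }

s : ℕ → ℕ
s n = σ (Staircase n)

sumA : ℕ → ℕ
sumA n = sum (map (λ j → let i = suc j in
                          ((n ∸ 1) C (2 * i ∸ 1)) * s (2 * i ∸ 1) * s (n ∸ 2 * i))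
                  (upTo (n / 2)))

sumB : ℕ → ℕ
sumB n = sum (map (λ i → ((n ∸ 1) C (2 * i)) * s (2 * i) * s (n ∸ 2 * i ∸ 1))
                  (upTo (suc ((n ∸ 1) / 2))))

-- Reading a disposition f of 𝔖ₙ as the list f(v₁), …, f(vₙ), the arcs say exactly that this
-- permutation of {0, …, n-1} is a down-up zigzag: π₀ > π₁ < π₂ > ⋯.  So sₙ is the number of such
-- zigzags, i.e. the sum over all permutations of a 0/1 zigzag weight.  In a zigzag of length m+1
-- the largest value sits at an even position 2i; the entries to its left form a down-up zigzag,
-- those to its right an up-down one, and which values go left is an arbitrary 2i-subset of the
-- other m.  Since relabelling preserves zigzags and complementing values turns up-down zigzags
-- into down-up ones, this gives sₘ₊₁ = ∑ C(m,2i) s₂ᵢ sₘ₋₂ᵢ.  Placing the smallest value instead,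
-- which sits at an odd position 2i+1 once m ≥ 1, gives the other recurrence.

module Submission where

open import Defs
open import Data.Bool using (true; false; if_then_else_; T)
open import Data.Bool.Properties using (T-∧; T-∨)
open import Data.Fin using (Fin; toℕ; inject₁) renaming (zero to fzero; suc to fsuc)
open import Data.Fin.Properties using (toℕ<n; toℕ-injective; toℕ-inject₁) renaming (_≟_ to _≟ᶠ_)
open import Data.List
  using (List; []; _∷_; [_]; _++_; map; length; concatMap; filter; take; drop; lookup; tabulate; allFin;
         reverse; upTo; downFrom; applyUpTo)
open import Data.List.Properties
  using (map-cong; map-cong-local; map-++; map-∘; map-tabulate; map-upTo; map-concatMap; concatMap-cong;
         length-++; length-map; length-take; length-upTo; length-applyUpTo; take++drop≡id; tabulate-lookup;
         reverse-upTo; upTo-∷ʳ; filter-all; filter-accept; filter-reject)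
open import Data.List.Relation.Binary.Permutation.Propositional
  using (_↭_; prep; swap; ↭-refl; ↭-trans; ↭-sym)
open import Data.List.Relation.Binary.Permutation.Propositional.Properties
  using (All-resp-↭; ↭-length; ↭-reverse; ∷↭∷ʳ)
open import Data.List.Relation.Ternary.Interleaving.Propositional using (Interleaving; []; consˡ; consʳ)
open import Data.List.Relation.Ternary.Interleaving.Properties using (interleave-length)
open import Data.List.Relation.Unary.All using (All; []; _∷_)
import Data.List.Relation.Unary.All as All
open import Data.List.Relation.Unary.All.Properties using (all-upTo; applyUpTo⁺₂; tabulate⁺; tabulate⁻)
import Data.List.Relation.Unary.All.Properties as All
open import Data.List.Relation.Unary.AllPairs using (AllPairs; []; _∷_)
open import Data.List.Relation.Unary.AllPairs.Properties using (applyUpTo⁺₁)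
open import Data.List.Relation.Unary.Unique.Propositional using (Unique)
import Data.List.Relation.Unary.Unique.Propositional.Properties as Unique
import Data.List.Relation.Unary.Unique.DecPropositional as UniqueDec
open import Data.Nat using (ℕ; zero; suc; _+_; _*_; _∸_; _≤_; _<_; z≤n; s≤s; _<?_)
open import Data.Nat.Combinatorics using (_C_; nCk+nC[k+1]≡[n+1]C[k+1])
open import Data.Nat.DivMod using (_/_; m/n≡1+[m∸n]/n)
open import Data.Nat.ListAction using (sum)
open import Data.Nat.ListAction.Properties using (sum-++)
open import Data.Nat.Properties
open import Algebra.Properties.CommutativeSemigroup +-commutativeSemigroup using ()
  renaming (x∙yz≈y∙xz to m+[n+o]≡n+[m+o])
open import Data.Product using (_×_; _,_; proj₁; proj₂)
open import Data.Sum using (_⊎_; inj₁; inj₂)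
open import Data.Vec using (Vec; toList) renaming ([] to []ᵥ; _∷_ to _∷ᵥ_)
import Data.Vec as Vec
open import Function using (id; _∘_; case_of_)
open import Function.Bundles using (_⇔_; mk⇔; Equivalence)
open import Function.Construct.Composition using (_⇔-∘_)
open import Function.Construct.Symmetry using (⇔-sym)
open import Relation.Binary.Definitions using (tri<; tri≈; tri>; DecidableEquality)
open import Relation.Binary.PropositionalEquality hiding ([_])
open import Relation.Nullary using (Dec; yes; no; does; ¬_; contradiction)
open import Relation.Nullary.Decidable using (_×-dec_; ¬?)
open import Relation.Unary using (Decidable)

open ≡-Reasoning

private variable
  A B : Set
  P Q : Set

-- Indicators and finite sums

⟦_⟧ : Dec P → ℕ
⟦ d ⟧ = if does d then 1 else 0

⟦⟧-yes : (d : Dec P) → P → ⟦ d ⟧ ≡ 1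
⟦⟧-yes (yes _) _ = refl
⟦⟧-yes (no ¬p) p = contradiction p ¬p

⟦⟧-no : (d : Dec P) → ¬ P → ⟦ d ⟧ ≡ 0
⟦⟧-no (yes p) ¬p = contradiction p ¬p
⟦⟧-no (no _) _ = refl

⟦⟧≡1⇒ : (d : Dec P) → ⟦ d ⟧ ≡ 1 → P
⟦⟧≡1⇒ (yes p) _ = p

⟦⟧≤1 : (d : Dec P) → ⟦ d ⟧ ≤ 1
⟦⟧≤1 (yes _) = s≤s z≤n
⟦⟧≤1 (no _) = z≤n

⟦⟧-cong : (p : Dec P) (q : Dec Q) → P ⇔ Q → ⟦ p ⟧ ≡ ⟦ q ⟧
⟦⟧-cong (yes p) q P⇔Q = sym (⟦⟧-yes q (Equivalence.to P⇔Q p))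
⟦⟧-cong (no ¬p) q P⇔Q = sym (⟦⟧-no q (¬p ∘ Equivalence.from P⇔Q))

⟦⟧-unique : (d : Dec P) {n : ℕ} → n ≤ 1 → P ⇔ n ≡ 1 → ⟦ d ⟧ ≡ n
⟦⟧-unique d {zero} _ P⇔0≡1 = ⟦⟧-no d (λ p → case Equivalence.to P⇔0≡1 p of λ ())
⟦⟧-unique d {suc zero} _ P⇔1≡1 = ⟦⟧-yes d (Equivalence.from P⇔1≡1 refl)
⟦⟧-unique d {suc (suc _)} (s≤s ()) _

⟦⟧-×-dec : (p : Dec P) (q : Dec Q) → ⟦ p ×-dec q ⟧ ≡ ⟦ p ⟧ * ⟦ q ⟧
⟦⟧-×-dec (yes _) (yes _) = refl
⟦⟧-×-dec (yes _) (no _) = refl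
⟦⟧-×-dec (no _) _ = refl

∑ : List A → (A → ℕ) → ℕ
∑ xs f = sum (map f xs)

infix 6.5 ∑
syntax ∑ xs (λ x → e) = ∑[ x ∈ xs ] e

∑-cong : (xs : List A) {f g : A → ℕ} → (∀ x → f x ≡ g x) → ∑ xs f ≡ ∑ xs g
∑-cong xs f≗g = cong sum (map-cong f≗g xs)

∑-congᴬ : {xs : List A} {f g : A → ℕ} → All (λ x → f x ≡ g x) xs → ∑ xs f ≡ ∑ xs g
∑-congᴬ f≗g = cong sum (map-cong-local f≗g)

∑-++ : (xs ys : List A) (f : A → ℕ) → ∑ (xs ++ ys) f ≡ ∑ xs f + ∑ ys f
∑-++ xs ys f = trans (cong sum (map-++ f xs ys)) (sum-++ (map f xs) (map f ys))

∑-map : (h : B → A) (xs : List B) (f : A → ℕ) → ∑ (map h xs) f ≡ ∑ xs (f ∘ h)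
∑-map h xs f = cong sum (sym (map-∘ xs))

∑-concatMap : (g : B → List A) (xs : List B) (f : A → ℕ) →
              ∑ (concatMap g xs) f ≡ ∑[ x ∈ xs ] ∑ (g x) f
∑-concatMap g [] f = refl
∑-concatMap g (x ∷ xs) f =
  trans (∑-++ (g x) (concatMap g xs) f) (cong (∑ (g x) f +_) (∑-concatMap g xs f))

∑-+ : (xs : List A) (f g : A → ℕ) → ∑[ x ∈ xs ] (f x + g x) ≡ ∑ xs f + ∑ xs g
∑-+ [] f g = refl
∑-+ (x ∷ xs) f g = begin
  f x + g x + ∑[ y ∈ xs ] (f y + g y) ≡⟨ cong (f x + g x +_) (∑-+ xs f g) ⟩
  f x + g x + (∑ xs f + ∑ xs g)       ≡⟨ +-assoc (f x) (g x) _ ⟩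
  f x + (g x + (∑ xs f + ∑ xs g))     ≡⟨ cong (f x +_) (m+[n+o]≡n+[m+o] (g x) (∑ xs f) _) ⟩
  f x + (∑ xs f + (g x + ∑ xs g))     ≡⟨ +-assoc (f x) _ _ ⟨
  f x + ∑ xs f + (g x + ∑ xs g)       ∎

∑-*ˡ : (xs : List A) (c : ℕ) (f : A → ℕ) → ∑[ x ∈ xs ] (c * f x) ≡ c * ∑ xs f
∑-*ˡ [] c f = sym (*-zeroʳ c)
∑-*ˡ (x ∷ xs) c f = trans (cong (c * f x +_) (∑-*ˡ xs c f)) (sym (*-distribˡ-+ c (f x) _))

∑-*ʳ : (xs : List A) (c : ℕ) (f : A → ℕ) → ∑[ x ∈ xs ] (f x * c) ≡ ∑ xs f * c
∑-*ʳ xs c f = begin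
  ∑[ x ∈ xs ] (f x * c) ≡⟨ ∑-cong xs (λ x → *-comm (f x) c) ⟩
  ∑[ x ∈ xs ] (c * f x) ≡⟨ ∑-*ˡ xs c f ⟩
  c * ∑ xs f            ≡⟨ *-comm c _ ⟩
  ∑ xs f * c            ∎

∑-const : (xs : List A) (c : ℕ) → ∑[ x ∈ xs ] c ≡ length xs * c
∑-const [] c = refl
∑-const (x ∷ xs) c = cong (c +_) (∑-const xs c)

∑-zero : (xs : List A) → ∑[ x ∈ xs ] 0 ≡ 0
∑-zero xs = trans (∑-const xs 0) (*-zeroʳ (length xs))

∑-comm : (xs : List A) (ys : List B) (f : A → B → ℕ) →
         ∑[ x ∈ xs ] ∑[ y ∈ ys ] f x y ≡ ∑[ y ∈ ys ] ∑[ x ∈ xs ] f x y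
∑-comm [] ys f = sym (∑-zero ys)
∑-comm (x ∷ xs) ys f = begin
  ∑ ys (f x) + ∑[ x′ ∈ xs ] ∑ ys (f x′)      ≡⟨ cong (∑ ys (f x) +_) (∑-comm xs ys f) ⟩
  ∑ ys (f x) + ∑[ y ∈ ys ] ∑[ x′ ∈ xs ] f x′ y ≡⟨ ∑-+ ys (f x) _ ⟨
  ∑[ y ∈ ys ] (f x y + ∑[ x′ ∈ xs ] f x′ y) ∎

∑-filter : {P : A → Set} (P? : Decidable P) (xs : List A) (f : A → ℕ) →
           ∑[ x ∈ xs ] (⟦ P? x ⟧ * f x) ≡ ∑ (filter P? xs) f
∑-filter P? [] f = refl
∑-filter P? (x ∷ xs) f with does (P? x)
... | true = cong₂ _+_ (+-identityʳ (f x)) (∑-filter P? xs f)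
... | false = ∑-filter P? xs f

length-filter : {P : A → Set} (P? : Decidable P) (xs : List A) → length (filter P? xs) ≡ ∑[ x ∈ xs ] ⟦ P? x ⟧
length-filter P? xs = begin
  length (filter P? xs)              ≡⟨ *-identityʳ _ ⟨
  length (filter P? xs) * 1          ≡⟨ ∑-const (filter P? xs) 1 ⟨
  ∑[ x ∈ filter P? xs ] 1            ≡⟨ ∑-filter P? xs (λ _ → 1) ⟨
  ∑[ x ∈ xs ] ⟦ P? x ⟧ * 1           ≡⟨ ∑-cong xs (λ x → *-identityʳ ⟦ P? x ⟧) ⟩
  ∑[ x ∈ xs ] ⟦ P? x ⟧               ∎

∑-upTo-suc : (n : ℕ) (f : ℕ → ℕ) → ∑ (upTo (suc n)) f ≡ f 0 + ∑[ k ∈ upTo n ] f (suc k)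
∑-upTo-suc n f = cong (f 0 +_) (trans (cong (λ ks → ∑ ks f) (sym (map-upTo suc n))) (∑-map suc (upTo n) f))

-- Sums over arrangements

consRest : A → A × List A → A × List A
consRest x (y , ys) = y , x ∷ ys

select : List A → List (A × List A)
select [] = []
select (x ∷ xs) = (x , xs) ∷ map (consRest x) (select xs)

∑select : List A → (A → List A → ℕ) → ℕ
∑select S F = ∑[ p ∈ select S ] F (proj₁ p) (proj₂ p)

∑select-∷ : (x : A) (xs : List A) (F : A → List A → ℕ) →
            ∑select (x ∷ xs) F ≡ F x xs + ∑select xs (λ y R → F y (x ∷ R))
∑select-∷ x xs F = cong (F x xs +_) (∑-map (consRest x) (select xs) _)

∑select-congᴾ : (S : List A) {F G : A → List A → ℕ} →
                (∀ x R → x ∷ R ↭ S → F x R ≡ G x R) → ∑select S F ≡ ∑select S G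
∑select-congᴾ [] F≗G = refl
∑select-congᴾ (x ∷ xs) {F} {G} F≗G = begin
  ∑select (x ∷ xs) F                                ≡⟨ ∑select-∷ x xs F ⟩
  F x xs + ∑select xs (λ y R → F y (x ∷ R))         ≡⟨ cong₂ _+_ (F≗G x xs ↭-refl) (∑select-congᴾ xs tail≗) ⟩
  G x xs + ∑select xs (λ y R → G y (x ∷ R))         ≡⟨ ∑select-∷ x xs G ⟨
  ∑select (x ∷ xs) G                                ∎
  where
  tail≗ : ∀ y R → y ∷ R ↭ xs → F y (x ∷ R) ≡ G y (x ∷ R)
  tail≗ y R yR↭xs = F≗G y (x ∷ R) (↭-trans (swap y x ↭-refl) (prep x yR↭xs))

∑select-map : (g : A → B) (S : List A) (F : B → List B → ℕ) →
              ∑select (map g S) F ≡ ∑select S (λ x R → F (g x) (map g R))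
∑select-map g [] F = refl
∑select-map g (x ∷ xs) F = begin
  ∑select (g x ∷ map g xs) F                                      ≡⟨ ∑select-∷ (g x) (map g xs) F ⟩
  F (g x) (map g xs) + ∑select (map g xs) (λ y R → F y (g x ∷ R))
    ≡⟨ cong (F (g x) (map g xs) +_) (∑select-map g xs _) ⟩
  F (g x) (map g xs) + ∑select xs (λ y R → F (g y) (map g (x ∷ R))) ≡⟨ ∑select-∷ x xs _ ⟨
  ∑select (x ∷ xs) (λ y R → F (g y) (map g R))                    ∎

∑select-↭ : {S S′ : List A} → S ↭ S′ → (F : A → List A → ℕ) →
            (∀ x {R R′} → R ↭ R′ → F x R ≡ F x R′) → ∑select S F ≡ ∑select S′ F
∑select-↭ _↭_.refl F F-resp-↭ = refl
∑select-↭ {S = x ∷ xs} {x ∷ ys} (prep x xs↭ys) F F-resp-↭ = begin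
  ∑select (x ∷ xs) F                            ≡⟨ ∑select-∷ x xs F ⟩
  F x xs + ∑select xs (λ y R → F y (x ∷ R))     ≡⟨ cong₂ _+_ (F-resp-↭ x xs↭ys)
                                                     (∑select-↭ xs↭ys _ (λ y → F-resp-↭ y ∘ prep x)) ⟩
  F x ys + ∑select ys (λ y R → F y (x ∷ R))     ≡⟨ ∑select-∷ x ys F ⟨
  ∑select (x ∷ ys) F                            ∎
∑select-↭ {S = x ∷ y ∷ xs} {y ∷ x ∷ ys} (swap x y xs↭ys) F F-resp-↭ = begin
  ∑select (x ∷ y ∷ xs) F
    ≡⟨ ∑select-∷ x (y ∷ xs) F ⟩
  F x (y ∷ xs) + ∑select (y ∷ xs) (λ z R → F z (x ∷ R))
    ≡⟨ cong (F x (y ∷ xs) +_) (∑select-∷ y xs _) ⟩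
  F x (y ∷ xs) + (F y (x ∷ xs) + ∑select xs (λ z R → F z (x ∷ y ∷ R)))
    ≡⟨ cong₂ (λ a b → a + (b + ∑select xs (λ z R → F z (x ∷ y ∷ R))))
         (F-resp-↭ x (prep y xs↭ys)) (F-resp-↭ y (prep x xs↭ys)) ⟩
  F x (y ∷ ys) + (F y (x ∷ ys) + ∑select xs (λ z R → F z (x ∷ y ∷ R)))
    ≡⟨ m+[n+o]≡n+[m+o] (F x (y ∷ ys)) (F y (x ∷ ys)) _ ⟩
  F y (x ∷ ys) + (F x (y ∷ ys) + ∑select xs (λ z R → F z (x ∷ y ∷ R)))
    ≡⟨ cong (λ t → F y (x ∷ ys) + (F x (y ∷ ys) + t)) swapped ⟩
  F y (x ∷ ys) + (F x (y ∷ ys) + ∑select ys (λ z R → F z (y ∷ x ∷ R)))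
    ≡⟨ cong (F y (x ∷ ys) +_) (∑select-∷ x ys _) ⟨
  F y (x ∷ ys) + ∑select (x ∷ ys) (λ z R → F z (y ∷ R))
    ≡⟨ ∑select-∷ y (x ∷ ys) F ⟨
  ∑select (y ∷ x ∷ ys) F ∎
  where
  swapped : ∑select xs (λ z R → F z (x ∷ y ∷ R)) ≡ ∑select ys (λ z R → F z (y ∷ x ∷ R))
  swapped = trans (∑select-↭ xs↭ys _ (λ z → F-resp-↭ z ∘ prep x ∘ prep y))
                  (∑select-congᴾ ys (λ z R _ → F-resp-↭ z (swap x y ↭-refl)))
∑select-↭ (_↭_.trans S↭S′ S′↭S″) F F-resp-↭ =
  trans (∑select-↭ S↭S′ F F-resp-↭) (∑select-↭ S′↭S″ F F-resp-↭)

-- The sum of w over all lists of n entries of S taken from distinct positions of S.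
sumPerms : ℕ → List A → (List A → ℕ) → ℕ
sumPerms zero S w = w []
sumPerms (suc n) S w = ∑select S (λ x R → sumPerms n R (λ l → w (x ∷ l)))

sumPerms-cong : ∀ n (S : List A) {w w′ : List A → ℕ} → (∀ l → w l ≡ w′ l) →
                sumPerms n S w ≡ sumPerms n S w′
sumPerms-cong zero S w≗w′ = w≗w′ []
sumPerms-cong (suc n) S w≗w′ =
  ∑select-congᴾ S (λ x R _ → sumPerms-cong n R (λ l → w≗w′ (x ∷ l)))

sumPerms-congᴬ : (P : A → Set) → ∀ n {S : List A} {w w′ : List A → ℕ} → All P S →
                 (∀ l → All P l → length l ≡ n → w l ≡ w′ l) → sumPerms n S w ≡ sumPerms n S w′
sumPerms-congᴬ P zero PS w≗w′ = w≗w′ [] [] refl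
sumPerms-congᴬ P (suc n) {S} PS w≗w′ = ∑select-congᴾ S λ x R x∷R↭S →
  case All-resp-↭ (↭-sym x∷R↭S) PS of λ where
    (Px ∷ PR) → sumPerms-congᴬ P n PR (λ l Pl |l|≡n → w≗w′ (x ∷ l) (Px ∷ Pl) (cong suc |l|≡n))

sumPerms-*ˡ : ∀ n (S : List A) (c : ℕ) (w : List A → ℕ) →
              sumPerms n S (λ l → c * w l) ≡ c * sumPerms n S w
sumPerms-*ˡ zero S c w = refl
sumPerms-*ˡ (suc n) S c w =
  trans (∑select-congᴾ S (λ x R _ → sumPerms-*ˡ n R c _)) (∑-*ˡ (select S) c _)

sumPerms-map : (g : A → B) → ∀ n (S : List A) (w : List B → ℕ) →
               sumPerms n (map g S) w ≡ sumPerms n S (w ∘ map g)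
sumPerms-map g zero S w = refl
sumPerms-map g (suc n) S w =
  trans (∑select-map g S _) (∑select-congᴾ S (λ x R _ → sumPerms-map g n R _))

sumPerms-↭ : ∀ n {S S′ : List A} (w : List A → ℕ) → S ↭ S′ → sumPerms n S w ≡ sumPerms n S′ w
sumPerms-↭ zero w S↭S′ = refl
sumPerms-↭ (suc n) w S↭S′ = ∑select-↭ S↭S′ _ (λ x → sumPerms-↭ n _)

sumPerms-insert : ∀ m (x : A) (S : List A) (w : List A → ℕ) → length S ≡ m →
                  sumPerms (suc m) (x ∷ S) w ≡
                  ∑[ k ∈ upTo (suc m) ] sumPerms m S (λ l → w (take k l ++ x ∷ drop k l))
sumPerms-insert zero x [] w refl = refl
sumPerms-insert {A = A} (suc m) x S w |S|≡1+m = begin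
  sumPerms (suc (suc m)) (x ∷ S) w
    ≡⟨ ∑select-∷ x S _ ⟩
  atFront + ∑select S (λ y R → sumPerms (suc m) (x ∷ R) (λ l → w (y ∷ l)))
    ≡⟨ cong (atFront +_) (∑select-congᴾ S λ y R y∷R↭S →
         sumPerms-insert m x R (λ l → w (y ∷ l)) (suc-injective (trans (↭-length y∷R↭S) |S|≡1+m))) ⟩
  atFront + ∑select S (λ y R → ∑[ k ∈ upTo (suc m) ] insertedAt (suc k) y R)
    ≡⟨ cong (atFront +_) (∑-comm (select S) (upTo (suc m)) (λ p k → insertedAt (suc k) (proj₁ p) (proj₂ p))) ⟩
  atFront + ∑[ k ∈ upTo (suc m) ] ∑select S (insertedAt (suc k))
    ≡⟨ ∑-upTo-suc (suc m) (λ k → sumPerms (suc m) S (λ l → w (take k l ++ x ∷ drop k l))) ⟨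
  ∑[ k ∈ upTo (suc (suc m)) ] sumPerms (suc m) S (λ l → w (take k l ++ x ∷ drop k l)) ∎
  where
  atFront : ℕ
  atFront = sumPerms (suc m) S (λ l → w (x ∷ l))
  insertedAt : ℕ → A → List A → ℕ
  insertedAt k y R = sumPerms m R (λ l → w (take k (y ∷ l) ++ x ∷ drop k (y ∷ l)))

toLeft : A → List A × List A → List A × List A
toLeft x (L , R) = x ∷ L , R

toRight : A → List A × List A → List A × List A
toRight x (L , R) = L , x ∷ R

splits : ℕ → List A → List (List A × List A)
splits zero S = [ [] , S ]
splits (suc k) [] = []
splits (suc k) (x ∷ xs) = map (toLeft x) (splits k xs) ++ map (toRight x) (splits (suc k) xs)

∑splits : ℕ → List A → (List A → List A → ℕ) → ℕ
∑splits k S F = ∑[ q ∈ splits k S ] F (proj₁ q) (proj₂ q)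

∑splits-∷ : ∀ k (x : A) xs (F : List A → List A → ℕ) →
            ∑splits (suc k) (x ∷ xs) F ≡
            ∑splits k xs (λ L R → F (x ∷ L) R) + ∑splits (suc k) xs (λ L R → F L (x ∷ R))
∑splits-∷ k x xs F = trans (∑-++ (map (toLeft x) (splits k xs)) _ _)
  (cong₂ _+_ (∑-map (toLeft x) (splits k xs) _) (∑-map (toRight x) (splits (suc k) xs) _))

∑splits-congᴵ : ∀ k (S : List A) {F G : List A → List A → ℕ} →
                (∀ L R → Interleaving L R S → length L ≡ k → F L R ≡ G L R) →
                ∑splits k S F ≡ ∑splits k S G
∑splits-congᴵ zero S F≗G = cong (_+ 0) (F≗G [] S (Interleaving-right S) refl)
  where
  Interleaving-right : ∀ R → Interleaving [] R R
  Interleaving-right [] = []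
  Interleaving-right (x ∷ R) = consʳ (Interleaving-right R)
∑splits-congᴵ (suc k) [] F≗G = refl
∑splits-congᴵ (suc k) (x ∷ xs) {F} {G} F≗G = begin
  ∑splits (suc k) (x ∷ xs) F
    ≡⟨ ∑splits-∷ k x xs F ⟩
  ∑splits k xs (λ L R → F (x ∷ L) R) + ∑splits (suc k) xs (λ L R → F L (x ∷ R))
    ≡⟨ cong₂ _+_ (∑splits-congᴵ k xs (λ L R I |L|≡k → F≗G (x ∷ L) R (consˡ I) (cong suc |L|≡k)))
                 (∑splits-congᴵ (suc k) xs (λ L R I |L|≡1+k → F≗G L (x ∷ R) (consʳ I) |L|≡1+k)) ⟩
  ∑splits k xs (λ L R → G (x ∷ L) R) + ∑splits (suc k) xs (λ L R → G L (x ∷ R))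
    ≡⟨ ∑splits-∷ k x xs G ⟨
  ∑splits (suc k) (x ∷ xs) G ∎

length-splits : ∀ k (S : List A) → length (splits k S) ≡ length S C k
length-splits zero S = refl
length-splits (suc k) [] = refl
length-splits (suc k) (x ∷ xs) = begin
  length (map (toLeft x) (splits k xs) ++ map (toRight x) (splits (suc k) xs))
    ≡⟨ length-++ (map (toLeft x) (splits k xs)) ⟩
  length (map (toLeft x) (splits k xs)) + length (map (toRight x) (splits (suc k) xs))
    ≡⟨ cong₂ _+_ (length-map (toLeft x) (splits k xs)) (length-map (toRight x) (splits (suc k) xs)) ⟩
  length (splits k xs) + length (splits (suc k) xs)
    ≡⟨ cong₂ _+_ (length-splits k xs) (length-splits (suc k) xs) ⟩
  length xs C k + length xs C suc k
    ≡⟨ nCk+nC[k+1]≡[n+1]C[k+1] (length xs) k ⟩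
  suc (length xs) C suc k ∎

Interleaving-All : {P : A → Set} {L R S : List A} → Interleaving L R S → All P S → All P L × All P R
Interleaving-All [] [] = [] , []
Interleaving-All (consˡ I) (px ∷ pxs) = let (pL , pR) = Interleaving-All I pxs in px ∷ pL , pR
Interleaving-All (consʳ I) (px ∷ pxs) = let (pL , pR) = Interleaving-All I pxs in pL , px ∷ pR

Interleaving-AllPairs : {_∼_ : A → A → Set} {L R S : List A} → Interleaving L R S →
                        AllPairs _∼_ S → AllPairs _∼_ L × AllPairs _∼_ R
Interleaving-AllPairs [] [] = [] , []
Interleaving-AllPairs (consˡ I) (x∼xs ∷ related) =
  let (rL , rR) = Interleaving-AllPairs I related in proj₁ (Interleaving-All I x∼xs) ∷ rL , rR
Interleaving-AllPairs (consʳ I) (x∼xs ∷ related) =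
  let (rL , rR) = Interleaving-AllPairs I related in rL , proj₂ (Interleaving-All I x∼xs) ∷ rR

-- Both sides enumerate the ways to pick an entry x and split the remaining entries into L′ and R′ with
-- k entries in L′; they differ only in whether x is picked before or after R′ is split off.
∑select-∑splits : (S : List A) → ∀ k (G : A → List A → List A → ℕ) →
                  ∑select S (λ x R → ∑splits k R (G x)) ≡
                  ∑splits (suc k) S (λ L R → ∑select L (λ x L′ → G x L′ R))
∑select-∑splits [] k G = refl
∑select-∑splits (y ∷ ys) k G = begin
  ∑select (y ∷ ys) (λ x R → ∑splits k R (G x))
    ≡⟨ ∑select-∷ y ys _ ⟩
  ∑splits k ys (G y) + ∑select ys (λ x R → ∑splits k (y ∷ R) (G x))
    ≡⟨ cong (∑splits k ys (G y) +_) (rest k) ⟩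
  ∑splits k ys (G y) + (yLeft + yRight)
    ≡⟨ +-assoc (∑splits k ys (G y)) yLeft yRight ⟨
  ∑splits k ys (G y) + yLeft + yRight
    ≡⟨ cong (_+ yRight) (∑-+ (splits k ys) (λ q → G y (proj₁ q) (proj₂ q)) _) ⟨
  ∑splits k ys (λ L R → G y L R + ∑select L (λ x L′ → G x (y ∷ L′) R)) + yRight
    ≡⟨ cong (_+ yRight) (∑-cong (splits k ys) (λ q → ∑select-∷ y (proj₁ q) (λ x L′ → G x L′ (proj₂ q)))) ⟨
  ∑splits k ys (λ L R → ∑select (y ∷ L) (λ x L′ → G x L′ R)) + yRight
    ≡⟨ ∑splits-∷ k y ys _ ⟨
  ∑splits (suc k) (y ∷ ys) (λ L R → ∑select L (λ x L′ → G x L′ R)) ∎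
  where
  yLeft yRight : ℕ
  yLeft = ∑splits k ys (λ L R → ∑select L (λ x L′ → G x (y ∷ L′) R))
  yRight = ∑splits (suc k) ys (λ L R → ∑select L (λ x L′ → G x L′ (y ∷ R)))
  rest : ∀ j → ∑select ys (λ x R → ∑splits j (y ∷ R) (G x)) ≡
               ∑splits j ys (λ L R → ∑select L (λ x L′ → G x (y ∷ L′) R)) +
               ∑splits (suc j) ys (λ L R → ∑select L (λ x L′ → G x L′ (y ∷ R)))
  rest zero = ∑select-∑splits ys zero (λ x L R → G x L (y ∷ R))
  rest (suc j) = begin
    ∑select ys (λ x R → ∑splits (suc j) (y ∷ R) (G x))
      ≡⟨ ∑select-congᴾ ys (λ x R _ → ∑splits-∷ j y R (G x)) ⟩
    ∑select ys (λ x R → ∑splits j R (λ L R′ → G x (y ∷ L) R′) + ∑splits (suc j) R (λ L R′ → G x L (y ∷ R′)))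
      ≡⟨ ∑-+ (select ys) _ _ ⟩
    ∑select ys (λ x R → ∑splits j R (λ L R′ → G x (y ∷ L) R′)) +
    ∑select ys (λ x R → ∑splits (suc j) R (λ L R′ → G x L (y ∷ R′)))
      ≡⟨ cong₂ _+_ (∑select-∑splits ys j (λ x L R → G x (y ∷ L) R))
                   (∑select-∑splits ys (suc j) (λ x L R → G x L (y ∷ R))) ⟩
    _ ∎

sumPerms-split : ∀ k m (S : List A) (w₁ w₂ : List A → ℕ) →
                 sumPerms (k + m) S (λ l → w₁ (take k l) * w₂ (drop k l)) ≡
                 ∑splits k S (λ L R → sumPerms k L w₁ * sumPerms m R w₂)
sumPerms-split zero m S w₁ w₂ = trans (sumPerms-*ˡ m S (w₁ []) w₂) (sym (+-identityʳ _))
sumPerms-split (suc k) m S w₁ w₂ = begin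
  ∑select S (λ x R → sumPerms (k + m) R (λ l → w₁ (x ∷ take k l) * w₂ (drop k l)))
    ≡⟨ ∑select-congᴾ S (λ x R _ → sumPerms-split k m R (λ l → w₁ (x ∷ l)) w₂) ⟩
  ∑select S (λ x R → ∑splits k R (λ L R′ → sumPerms k L (λ l → w₁ (x ∷ l)) * sumPerms m R′ w₂))
    ≡⟨ ∑select-∑splits S k (λ x L R′ → sumPerms k L (λ l → w₁ (x ∷ l)) * sumPerms m R′ w₂) ⟩
  ∑splits (suc k) S (λ L R′ → ∑select L (λ x L′ → sumPerms k L′ (λ l → w₁ (x ∷ l)) * sumPerms m R′ w₂))
    ≡⟨ ∑-cong (splits (suc k) S) (λ q → ∑-*ʳ (select (proj₁ q)) (sumPerms m (proj₂ q) w₂) _) ⟩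
  ∑splits (suc k) S (λ L R′ → sumPerms (suc k) L w₁ * sumPerms m R′ w₂) ∎

-- Words with distinct letters

words : ℕ → List A → List (List A)
words zero U = [ [] ]
words (suc m) U = concatMap (λ x → map (x ∷_) (words m U)) U

∑-words-suc : ∀ m (U : List A) (G : List A → ℕ) →
              ∑ (words (suc m) U) G ≡ ∑[ x ∈ U ] ∑[ w ∈ words m U ] G (x ∷ w)
∑-words-suc m U G = trans (∑-concatMap _ U G) (∑-cong U (λ x → ∑-map (x ∷_) (words m U) G))

∑-words-All : {P : A → Set} (P? : Decidable P) → ∀ m (U : List A) (G : List A → ℕ) →
              ∑[ w ∈ words m U ] ⟦ All.all? P? w ⟧ * G w ≡ ∑ (words m (filter P? U)) G
∑-words-All P? zero U G = cong (_+ 0) (*-identityˡ (G []))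
∑-words-All P? (suc m) U G = begin
  ∑[ w ∈ words (suc m) U ] ⟦ All.all? P? w ⟧ * G w
    ≡⟨ ∑-words-suc m U _ ⟩
  ∑[ x ∈ U ] ∑[ w ∈ words m U ] ⟦ P? x ×-dec All.all? P? w ⟧ * G (x ∷ w)
    ≡⟨ ∑-cong U (λ x → ∑-cong (words m U) (λ w →
         trans (cong (_* G (x ∷ w)) (⟦⟧-×-dec (P? x) (All.all? P? w))) (*-assoc ⟦ P? x ⟧ _ _))) ⟩
  ∑[ x ∈ U ] ∑[ w ∈ words m U ] ⟦ P? x ⟧ * (⟦ All.all? P? w ⟧ * G (x ∷ w))
    ≡⟨ ∑-cong U (λ x → ∑-*ˡ (words m U) ⟦ P? x ⟧ _) ⟩
  ∑[ x ∈ U ] ⟦ P? x ⟧ * (∑[ w ∈ words m U ] ⟦ All.all? P? w ⟧ * G (x ∷ w))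
    ≡⟨ ∑-cong U (λ x → cong (⟦ P? x ⟧ *_) (∑-words-All P? m U (λ w → G (x ∷ w)))) ⟩
  ∑[ x ∈ U ] ⟦ P? x ⟧ * (∑[ w ∈ words m (filter P? U) ] G (x ∷ w))
    ≡⟨ ∑-filter P? U _ ⟩
  ∑[ x ∈ filter P? U ] ∑[ w ∈ words m (filter P? U) ] G (x ∷ w)
    ≡⟨ ∑-words-suc m (filter P? U) G ⟨
  ∑ (words (suc m) (filter P? U)) G ∎

module _ (_≟_ : DecidableEquality A) where

  open UniqueDec _≟_ using (unique?)

  without : A → List A → List A
  without x = filter (λ y → ¬? (x ≟ y))

  select-unique : {U : List A} → Unique U → select U ≡ map (λ x → x , without x U) U
  select-unique {[]} [] = refl
  select-unique {y ∷ ys} (y∉ys ∷ unique) = cong₂ (λ R ps → (y , R) ∷ ps) without-head (begin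
    map (consRest y) (select ys)                         ≡⟨ cong (map (consRest y)) (select-unique unique) ⟩
    map (consRest y) (map (λ x → x , without x ys) ys)   ≡⟨ map-∘ ys ⟨
    map (λ x → x , y ∷ without x ys) ys                  ≡⟨ map-cong-local (All.map without-tail y∉ys) ⟩
    map (λ x → x , without x (y ∷ ys)) ys                ∎)
    where
    without-head : ys ≡ without y (y ∷ ys)
    without-head = sym (trans (filter-reject (λ z → ¬? (y ≟ z)) (λ y≢y → y≢y refl))
                              (filter-all (λ z → ¬? (y ≟ z)) y∉ys))
    without-tail : ∀ {x} → ¬ y ≡ x → (x , y ∷ without x ys) ≡ (x , without x (y ∷ ys))
    without-tail y≢x = cong (_ ,_) (sym (filter-accept (λ z → ¬? (_ ≟ z)) (y≢x ∘ sym)))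

  ∑-words-unique : {U : List A} → Unique U → ∀ m (G : List A → ℕ) →
                   ∑[ w ∈ words m U ] ⟦ unique? w ⟧ * G w ≡ sumPerms m U G
  ∑-words-unique unique zero G = trans (+-identityʳ _) (*-identityˡ (G []))
  ∑-words-unique {U} unique (suc m) G = begin
    ∑[ w ∈ words (suc m) U ] ⟦ unique? w ⟧ * G w
      ≡⟨ ∑-words-suc m U _ ⟩
    ∑[ x ∈ U ] ∑[ w ∈ words m U ] ⟦ All.all? (λ y → ¬? (x ≟ y)) w ×-dec unique? w ⟧ * G (x ∷ w)
      ≡⟨ ∑-cong U (λ x → ∑-cong (words m U) (λ w →
           trans (cong (_* G (x ∷ w)) (⟦⟧-×-dec (All.all? (λ y → ¬? (x ≟ y)) w) (unique? w)))
                 (*-assoc ⟦ All.all? (λ y → ¬? (x ≟ y)) w ⟧ _ _))) ⟩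
    ∑[ x ∈ U ] ∑[ w ∈ words m U ] ⟦ All.all? (λ y → ¬? (x ≟ y)) w ⟧ * (⟦ unique? w ⟧ * G (x ∷ w))
      ≡⟨ ∑-cong U (λ x → ∑-words-All (λ y → ¬? (x ≟ y)) m U _) ⟩
    ∑[ x ∈ U ] ∑[ w ∈ words m (without x U) ] ⟦ unique? w ⟧ * G (x ∷ w)
      ≡⟨ ∑-cong U (λ x → ∑-words-unique (Unique.filter⁺ (λ y → ¬? (x ≟ y)) unique) m (λ w → G (x ∷ w))) ⟩
    ∑[ x ∈ U ] sumPerms m (without x U) (λ w → G (x ∷ w))
      ≡⟨ ∑-map (λ x → x , without x U) U _ ⟨
    ∑[ p ∈ map (λ x → x , without x U) U ] sumPerms m (proj₂ p) (λ w → G (proj₁ p ∷ w))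
      ≡⟨ cong (λ ps → ∑[ p ∈ ps ] sumPerms m (proj₂ p) (λ w → G (proj₁ p ∷ w))) (select-unique unique) ⟨
    sumPerms (suc m) U G ∎

-- Zigzags

data Step : Set where
  down up : Step

opposite : Step → Step
opposite down = up
opposite up = down

_≟ˢ_ : (d e : Step) → Dec (d ≡ e)
down ≟ˢ down = yes refl
down ≟ˢ up = no (λ ())
up ≟ˢ down = no (λ ())
up ≟ˢ up = yes refl

stepAt : Step → ℕ → Step
stepAt d zero = d
stepAt d (suc i) = stepAt (opposite d) i

stepAt-suc : ∀ d i → stepAt d (suc i) ≡ opposite (stepAt d i)
stepAt-suc down zero = refl
stepAt-suc up zero = refl
stepAt-suc d (suc i) = stepAt-suc (opposite d) i

Ordered : Step → ℕ → ℕ → Set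
Ordered down x y = y < x
Ordered up x y = x < y

ordered? : ∀ d x y → Dec (Ordered d x y)
ordered? down x y = y <? x
ordered? up x y = x <? y

zigzag : Step → List ℕ → ℕ
zigzag d [] = 1
zigzag d (x ∷ []) = 1
zigzag d (x ∷ y ∷ l) = ⟦ ordered? d x y ⟧ * zigzag (opposite d) (y ∷ l)

zigzag-++-∷ : ∀ d L y R → zigzag d (L ++ y ∷ R) ≡ zigzag d (L ++ [ y ]) * zigzag (stepAt d (length L)) (y ∷ R)
zigzag-++-∷ d [] y R = sym (*-identityˡ _)
zigzag-++-∷ d (z ∷ []) y R = cong (_* zigzag (opposite d) (y ∷ R)) (sym (*-identityʳ ⟦ ordered? d z y ⟧))
zigzag-++-∷ d (z ∷ z′ ∷ L) y R =
  trans (cong (⟦ ordered? d z z′ ⟧ *_) (zigzag-++-∷ (opposite d) (z′ ∷ L) y R))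
        (sym (*-assoc ⟦ ordered? d z z′ ⟧ _ _))

ordered-extreme : ∀ e d {x y} → Ordered e x y → ⟦ ordered? d x y ⟧ ≡ ⟦ d ≟ˢ e ⟧
ordered-extreme down down y<x = ⟦⟧-yes (ordered? down _ _) y<x
ordered-extreme down up y<x = ⟦⟧-no (ordered? up _ _) (<-asym y<x)
ordered-extreme up down x<y = ⟦⟧-no (ordered? down _ _) (<-asym x<y)
ordered-extreme up up x<y = ⟦⟧-yes (ordered? up _ _) x<y

ordered-flip : ∀ e {x y} → Ordered e x y → Ordered (opposite e) y x
ordered-flip down y<x = y<x
ordered-flip up x<y = x<y

-- For a list whose steps alternate starting with d: endsWith e d k says that the step into position k
-- goes in direction e, startsWith e d r that the first step does when r entries follow the first one.
-- Both are 1 when the step does not exist.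
endsWith : Step → Step → ℕ → ℕ
endsWith e d zero = 1
endsWith e d (suc k) = ⟦ stepAt d k ≟ˢ e ⟧

startsWith : Step → Step → ℕ → ℕ
startsWith e d zero = 1
startsWith e d (suc _) = ⟦ d ≟ˢ e ⟧

zigzag-∷ʳ-extreme : ∀ e d x L → All (λ z → Ordered e z x) L →
                    zigzag d (L ++ [ x ]) ≡ zigzag d L * endsWith e d (length L)
zigzag-∷ʳ-extreme e d x [] _ = refl
zigzag-∷ʳ-extreme e d x (z ∷ []) (zx ∷ _) =
  trans (*-identityʳ _) (trans (ordered-extreme e d zx) (sym (*-identityˡ _)))
zigzag-∷ʳ-extreme e d x (z ∷ z′ ∷ L) (_ ∷ extreme) =
  trans (cong (⟦ ordered? d z z′ ⟧ *_) (zigzag-∷ʳ-extreme e (opposite d) x (z′ ∷ L) extreme))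
        (sym (*-assoc ⟦ ordered? d z z′ ⟧ _ _))

zigzag-∷-extreme : ∀ e d x R → All (Ordered e x) R →
                   zigzag d (x ∷ R) ≡ startsWith e d (length R) * zigzag (opposite e) R
zigzag-∷-extreme e d x [] _ = refl
zigzag-∷-extreme e d x (y ∷ R) (xy ∷ _) with d ≟ˢ e
... | yes refl = cong (_* zigzag (opposite d) (y ∷ R)) (trans (ordered-extreme e d xy) (⟦⟧-yes (d ≟ˢ d) refl))
... | no d≢e = cong (_* zigzag (opposite d) (y ∷ R)) (trans (ordered-extreme e d xy) (⟦⟧-no (d ≟ˢ e) d≢e))

-- The side condition excludes the one-element list, which is a zigzag in either direction.
extreme-junction : ∀ e d k r → d ≡ e ⊎ 0 < k + r →
                   endsWith (opposite e) d k * startsWith e (stepAt d k) r ≡ ⟦ stepAt d k ≟ˢ e ⟧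
extreme-junction down .down zero zero (inj₁ refl) = refl
extreme-junction up .up zero zero (inj₁ refl) = refl
extreme-junction e d zero (suc r) _ = *-identityˡ _
extreme-junction e d (suc k) r _ = begin
  ⟦ stepAt d k ≟ˢ opposite e ⟧ * startsWith e (stepAt d (suc k)) r
    ≡⟨ cong (λ a → ⟦ stepAt d k ≟ˢ opposite e ⟧ * startsWith e a r) (stepAt-suc d k) ⟩
  ⟦ stepAt d k ≟ˢ opposite e ⟧ * startsWith e (opposite (stepAt d k)) r
    ≡⟨ turn (stepAt d k) e r ⟩
  ⟦ opposite (stepAt d k) ≟ˢ e ⟧
    ≡⟨ cong (λ a → ⟦ a ≟ˢ e ⟧) (stepAt-suc d k) ⟨
  ⟦ stepAt d (suc k) ≟ˢ e ⟧ ∎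
  where
  turn : ∀ a e r → ⟦ a ≟ˢ opposite e ⟧ * startsWith e (opposite a) r ≡ ⟦ opposite a ≟ˢ e ⟧
  turn down down r = refl
  turn down up zero = refl
  turn down up (suc r) = refl
  turn up down zero = refl
  turn up down (suc r) = refl
  turn up up r = refl

zigzag-extreme : ∀ e d x L R → All (Ordered e x) L → All (Ordered e x) R →
                 d ≡ e ⊎ 0 < length L + length R →
                 zigzag d (L ++ x ∷ R) ≡ ⟦ stepAt d (length L) ≟ˢ e ⟧ * (zigzag d L * zigzag (opposite e) R)
zigzag-extreme e d x L R xL xR nontrivial = begin
  zigzag d (L ++ x ∷ R)
    ≡⟨ zigzag-++-∷ d L x R ⟩
  zigzag d (L ++ [ x ]) * zigzag (stepAt d k) (x ∷ R)
    ≡⟨ cong₂ _*_ (zigzag-∷ʳ-extreme (opposite e) d x L (All.map (ordered-flip e) xL))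
                 (zigzag-∷-extreme e (stepAt d k) x R xR) ⟩
  (zigzag d L * ends) * (starts * zigzag (opposite e) R)
    ≡⟨ cong (_* (starts * zigzag (opposite e) R)) (*-comm (zigzag d L) ends) ⟩
  (ends * zigzag d L) * (starts * zigzag (opposite e) R)
    ≡⟨ [m*n]*[o*p]≡[m*o]*[n*p] ends (zigzag d L) starts _ ⟩
  (ends * starts) * (zigzag d L * zigzag (opposite e) R)
    ≡⟨ cong (_* (zigzag d L * zigzag (opposite e) R)) (extreme-junction e d k (length R) nontrivial) ⟩
  ⟦ stepAt d k ≟ˢ e ⟧ * (zigzag d L * zigzag (opposite e) R) ∎
  where
  k ends starts : ℕ
  k = length L
  ends = endsWith (opposite e) d k
  starts = startsWith e (stepAt d k) (length R)

zigzag-map-≅ : (f g : A → ℕ) → (∀ a b → f a < f b ⇔ g a < g b) →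
               ∀ d l → zigzag d (map f l) ≡ zigzag d (map g l)
zigzag-map-≅ f g f≅g d [] = refl
zigzag-map-≅ f g f≅g d (x ∷ []) = refl
zigzag-map-≅ f g f≅g d (x ∷ y ∷ l) =
  cong₂ _*_ (⟦⟧-cong (ordered? d (f x) (f y)) (ordered? d (g x) (g y)) (same d))
            (zigzag-map-≅ f g f≅g (opposite d) (y ∷ l))
  where
  same : ∀ d → Ordered d (f x) (f y) ⇔ Ordered d (g x) (g y)
  same down = f≅g y x
  same up = f≅g x y

zigzag-map-≅ᵒᵖ : (f g : A → ℕ) → (∀ a b → f a < f b ⇔ g b < g a) →
                 ∀ d l → zigzag d (map f l) ≡ zigzag (opposite d) (map g l)
zigzag-map-≅ᵒᵖ f g f≅g d [] = refl
zigzag-map-≅ᵒᵖ f g f≅g d (x ∷ []) = refl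
zigzag-map-≅ᵒᵖ f g f≅g d (x ∷ y ∷ l) =
  cong₂ _*_ (⟦⟧-cong (ordered? d (f x) (f y)) (ordered? (opposite d) (g x) (g y)) (same d))
            (zigzag-map-≅ᵒᵖ f g f≅g (opposite d) (y ∷ l))
  where
  same : ∀ d → Ordered d (f x) (f y) ⇔ Ordered (opposite d) (g x) (g y)
  same down = f≅g y x
  same up = f≅g x y

lookup-<⇔ : {T : List ℕ} → AllPairs _<_ T → ∀ i j → lookup T i < lookup T j ⇔ toℕ i < toℕ j
lookup-<⇔ {T} sorted i j = mk⇔ reflect (lookup-strictMono sorted)
  where
  All-lookup : {P : ℕ → Set} {xs : List ℕ} → All P xs → (i : Fin (length xs)) → P (lookup xs i)
  All-lookup (px ∷ _) fzero = px
  All-lookup (_ ∷ pxs) (fsuc i) = All-lookup pxs i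
  lookup-strictMono : {T : List ℕ} → AllPairs _<_ T → ∀ {i j} → toℕ i < toℕ j → lookup T i < lookup T j
  lookup-strictMono (x<xs ∷ _) {fzero} {fsuc j} _ = All-lookup x<xs j
  lookup-strictMono (_ ∷ sorted) {fsuc i} {fsuc j} (s≤s i<j) = lookup-strictMono sorted i<j
  reflect : lookup T i < lookup T j → toℕ i < toℕ j
  reflect Ti<Tj with <-cmp (toℕ i) (toℕ j)
  ... | tri< i<j _ _ = i<j
  ... | tri≈ _ i≡j _ = contradiction Ti<Tj (<-irrefl (cong (lookup T) (toℕ-injective i≡j)))
  ... | tri> _ _ j<i = contradiction Ti<Tj (<-asym (lookup-strictMono sorted j<i))

map-toℕ-allFin : ∀ n → map toℕ (allFin n) ≡ upTo n
map-toℕ-allFin n = trans (map-tabulate (λ i → i) toℕ) (tabulate-toℕ n)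
  where
  tabulate-toℕ : ∀ n → tabulate {n = n} toℕ ≡ upTo n
  tabulate-toℕ zero = refl
  tabulate-toℕ (suc n) = cong (0 ∷_) (begin
    tabulate (suc ∘ toℕ) ≡⟨ map-tabulate toℕ suc ⟨
    map suc (tabulate toℕ) ≡⟨ cong (map suc) (tabulate-toℕ n) ⟩
    map suc (upTo n) ≡⟨ map-upTo suc n ⟩
    applyUpTo suc n ∎)

zigzags : Step → ℕ → ℕ
zigzags d n = sumPerms n (upTo n) (zigzag d)

sumPerms-relabel : ∀ d {T : List ℕ} {n} → AllPairs _<_ T → length T ≡ n →
                   sumPerms n T (zigzag d) ≡ zigzags d n
sumPerms-relabel d {T} {n} sorted refl = begin
  sumPerms n T (zigzag d)
    ≡⟨ cong (λ S → sumPerms n S (zigzag d)) (trans (map-tabulate (λ i → i) (lookup T)) (tabulate-lookup T)) ⟨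
  sumPerms n (map (lookup T) (allFin n)) (zigzag d)
    ≡⟨ sumPerms-map (lookup T) n (allFin n) (zigzag d) ⟩
  sumPerms n (allFin n) (zigzag d ∘ map (lookup T))
    ≡⟨ sumPerms-cong n (allFin n) (zigzag-map-≅ (lookup T) toℕ (lookup-<⇔ sorted) d) ⟩
  sumPerms n (allFin n) (zigzag d ∘ map toℕ)
    ≡⟨ sumPerms-map toℕ n (allFin n) (zigzag d) ⟨
  sumPerms n (map toℕ (allFin n)) (zigzag d)
    ≡⟨ cong (λ S → sumPerms n S (zigzag d)) (map-toℕ-allFin n) ⟩
  zigzags d n ∎

zigzags-opposite : ∀ d n → zigzags (opposite d) n ≡ zigzags d n
zigzags-opposite d n = begin
  sumPerms n (upTo n) (zigzag (opposite d))
    ≡⟨ cong (λ S → sumPerms n S (zigzag (opposite d))) (map-toℕ-allFin n) ⟨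
  sumPerms n (map toℕ (allFin n)) (zigzag (opposite d))
    ≡⟨ sumPerms-map toℕ n (allFin n) (zigzag (opposite d)) ⟩
  sumPerms n (allFin n) (zigzag (opposite d) ∘ map toℕ)
    ≡⟨ sumPerms-cong n (allFin n) (λ l → zigzag-map-≅ᵒᵖ complement toℕ complement-<⇔ d l) ⟨
  sumPerms n (allFin n) (zigzag d ∘ map complement)
    ≡⟨ sumPerms-map complement n (allFin n) (zigzag d) ⟨
  sumPerms n (map complement (allFin n)) (zigzag d)
    ≡⟨ sumPerms-↭ n (zigzag d) complement-↭ ⟩
  sumPerms n (upTo n) (zigzag d) ∎
  where
  complement : Fin n → ℕ
  complement i = n ∸ suc (toℕ i)
  complement-<⇔ : ∀ a b → complement a < complement b ⇔ toℕ b < toℕ a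
  complement-<⇔ a b = mk⇔
    (λ lt → ≰⇒> (λ a≤b → <⇒≱ lt (∸-monoʳ-≤ n (s≤s a≤b))))
    (λ b<a → ∸-monoʳ-< (s≤s b<a) (toℕ<n a))
  applyUpTo-complement : ∀ m → applyUpTo (λ i → m ∸ suc i) m ≡ downFrom m
  applyUpTo-complement zero = refl
  applyUpTo-complement (suc m) = cong (m ∷_) (applyUpTo-complement m)
  complement-allFin : map complement (allFin n) ≡ reverse (upTo n)
  complement-allFin = begin
    map complement (allFin n)                  ≡⟨ map-∘ (allFin n) ⟩
    map (λ i → n ∸ suc i) (map toℕ (allFin n)) ≡⟨ cong (map (λ i → n ∸ suc i)) (map-toℕ-allFin n) ⟩
    map (λ i → n ∸ suc i) (upTo n)             ≡⟨ map-upTo (λ i → n ∸ suc i) n ⟩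
    applyUpTo (λ i → n ∸ suc i) n              ≡⟨ applyUpTo-complement n ⟩
    downFrom n                                 ≡⟨ reverse-upTo n ⟨
    reverse (upTo n)                           ∎
  complement-↭ : map complement (allFin n) ↭ upTo n
  complement-↭ = subst (_↭ upTo n) (sym complement-allFin) (↭-reverse (upTo n))

-- The recurrences

sumPerms-zigzag-split : ∀ d₁ d₂ m k {S : List ℕ} → AllPairs _<_ S → length S ≡ m → k ≤ m →
                        sumPerms m S (λ l → zigzag d₁ (take k l) * zigzag d₂ (drop k l)) ≡
                        (m C k) * (zigzags d₁ k * zigzags d₂ (m ∸ k))
sumPerms-zigzag-split d₁ d₂ m k {S} sorted |S|≡m k≤m = begin
  sumPerms m S (λ l → zigzag d₁ (take k l) * zigzag d₂ (drop k l))
    ≡⟨ cong (λ j → sumPerms j S (λ l → zigzag d₁ (take k l) * zigzag d₂ (drop k l))) (m+[n∸m]≡n k≤m) ⟨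
  sumPerms (k + (m ∸ k)) S (λ l → zigzag d₁ (take k l) * zigzag d₂ (drop k l))
    ≡⟨ sumPerms-split k (m ∸ k) S (zigzag d₁) (zigzag d₂) ⟩
  ∑splits k S (λ L R → sumPerms k L (zigzag d₁) * sumPerms (m ∸ k) R (zigzag d₂))
    ≡⟨ ∑splits-congᴵ k S (λ L R I |L|≡k → let (sL , sR) = Interleaving-AllPairs I sorted in
         cong₂ _*_ (sumPerms-relabel d₁ sL |L|≡k) (sumPerms-relabel d₂ sR (|R|≡m∸k I |L|≡k))) ⟩
  ∑splits k S (λ _ _ → zigzags d₁ k * zigzags d₂ (m ∸ k))
    ≡⟨ ∑-const (splits k S) _ ⟩
  length (splits k S) * (zigzags d₁ k * zigzags d₂ (m ∸ k))
    ≡⟨ cong (_* (zigzags d₁ k * zigzags d₂ (m ∸ k))) (trans (length-splits k S) (cong (_C k) |S|≡m)) ⟩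
  (m C k) * (zigzags d₁ k * zigzags d₂ (m ∸ k)) ∎
  where
  |R|≡m∸k : ∀ {L R} → Interleaving L R S → length L ≡ k → length R ≡ m ∸ k
  |R|≡m∸k {L} {R} I refl = begin
    length R                        ≡⟨ m+n∸m≡n (length L) (length R) ⟨
    length L + length R ∸ length L  ≡⟨ cong (_∸ length L) (trans (sym (interleave-length I)) |S|≡m) ⟩
    m ∸ length L                    ∎

sumPerms-insert-extreme : ∀ e m x {S : List ℕ} → AllPairs _<_ S → length S ≡ m → All (Ordered e x) S →
                          down ≡ e ⊎ 0 < m →
                          sumPerms (suc m) (x ∷ S) (zigzag down) ≡
                          ∑[ k ∈ upTo (suc m) ] ⟦ stepAt down k ≟ˢ e ⟧ *
                                                ((m C k) * (zigzags down k * zigzags (opposite e) (m ∸ k)))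
sumPerms-insert-extreme e m x {S} sorted |S|≡m xS nontrivial =
  trans (sumPerms-insert m x S (zigzag down) |S|≡m) (∑-congᴬ (All.map atPosition (all-upTo (suc m))))
  where
  atPosition : ∀ {k} → k < suc m →
               sumPerms m S (λ l → zigzag down (take k l ++ x ∷ drop k l)) ≡
               ⟦ stepAt down k ≟ˢ e ⟧ * ((m C k) * (zigzags down k * zigzags (opposite e) (m ∸ k)))
  atPosition {k} (s≤s k≤m) = begin
    sumPerms m S (λ l → zigzag down (take k l ++ x ∷ drop k l))
      ≡⟨ sumPerms-congᴬ (Ordered e x) m xS split ⟩
    sumPerms m S (λ l → ⟦ stepAt down k ≟ˢ e ⟧ * (zigzag down (take k l) * zigzag (opposite e) (drop k l)))
      ≡⟨ sumPerms-*ˡ m S ⟦ stepAt down k ≟ˢ e ⟧ _ ⟩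
    ⟦ stepAt down k ≟ˢ e ⟧ * sumPerms m S (λ l → zigzag down (take k l) * zigzag (opposite e) (drop k l))
      ≡⟨ cong (⟦ stepAt down k ≟ˢ e ⟧ *_) (sumPerms-zigzag-split down (opposite e) m k sorted |S|≡m k≤m) ⟩
    ⟦ stepAt down k ≟ˢ e ⟧ * ((m C k) * (zigzags down k * zigzags (opposite e) (m ∸ k))) ∎
    where
    |take|+|drop|≡|l| : ∀ l → length (take k l) + length (drop k l) ≡ length l
    |take|+|drop|≡|l| l = trans (sym (length-++ (take k l))) (cong length (take++drop≡id k l))
    split : ∀ l → All (Ordered e x) l → length l ≡ m →
            zigzag down (take k l ++ x ∷ drop k l) ≡
            ⟦ stepAt down k ≟ˢ e ⟧ * (zigzag down (take k l) * zigzag (opposite e) (drop k l))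
    split l xl refl = begin
      zigzag down (take k l ++ x ∷ drop k l)
        ≡⟨ zigzag-extreme e down x (take k l) (drop k l) (All.take⁺ k xl) (All.drop⁺ k xl)
             (Data.Sum.map₂ (subst (0 <_) (sym (|take|+|drop|≡|l| l))) nontrivial) ⟩
      ⟦ stepAt down (length (take k l)) ≟ˢ e ⟧ * (zigzag down (take k l) * zigzag (opposite e) (drop k l))
        ≡⟨ cong (λ j → ⟦ stepAt down j ≟ˢ e ⟧ * (zigzag down (take k l) * zigzag (opposite e) (drop k l)))
               (trans (length-take k l) (m≤n⇒m⊓n≡m k≤m)) ⟩
      ⟦ stepAt down k ≟ˢ e ⟧ * (zigzag down (take k l) * zigzag (opposite e) (drop k l)) ∎

upTo-sorted : ∀ n → AllPairs _<_ (upTo n)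
upTo-sorted n = applyUpTo⁺₁ (λ i → i) n (λ i<j _ → i<j)

zigzags-peak : ∀ m → zigzags down (suc m) ≡
               ∑[ k ∈ upTo (suc m) ] ⟦ stepAt down k ≟ˢ down ⟧ *
                                     ((m C k) * (zigzags down k * zigzags down (m ∸ k)))
zigzags-peak m = begin
  sumPerms (suc m) (upTo (suc m)) (zigzag down)
    ≡⟨ sumPerms-↭ (suc m) (zigzag down) (subst (_↭ m ∷ upTo m) (upTo-∷ʳ m) (↭-sym (∷↭∷ʳ m (upTo m)))) ⟩
  sumPerms (suc m) (m ∷ upTo m) (zigzag down)
    ≡⟨ sumPerms-insert-extreme down m m (upTo-sorted m) (length-upTo m) (all-upTo m) (inj₁ refl) ⟩
  ∑[ k ∈ upTo (suc m) ] ⟦ stepAt down k ≟ˢ down ⟧ * ((m C k) * (zigzags down k * zigzags up (m ∸ k)))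
    ≡⟨ ∑-cong (upTo (suc m)) (λ k → cong (λ z → ⟦ stepAt down k ≟ˢ down ⟧ * ((m C k) * (zigzags down k * z)))
                                          (zigzags-opposite down (m ∸ k))) ⟩
  ∑[ k ∈ upTo (suc m) ] ⟦ stepAt down k ≟ˢ down ⟧ * ((m C k) * (zigzags down k * zigzags down (m ∸ k))) ∎

zigzags-valley : ∀ m → 0 < m → zigzags down (suc m) ≡
                 ∑[ k ∈ upTo (suc m) ] ⟦ stepAt down k ≟ˢ up ⟧ *
                                       ((m C k) * (zigzags down k * zigzags down (m ∸ k)))
zigzags-valley m 0<m =
  sumPerms-insert-extreme up m 0 (applyUpTo⁺₁ suc m (λ i<j _ → s≤s i<j)) (length-applyUpTo suc m)
                          (applyUpTo⁺₂ suc m (λ _ → s≤s z≤n)) (inj₂ 0<m)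

[2+n]/2≡1+n/2 : ∀ n → suc (suc n) / 2 ≡ suc (n / 2)
[2+n]/2≡1+n/2 n = m/n≡1+[m∸n]/n {suc (suc n)} {2} (s≤s (s≤s z≤n))

∑-even : ∀ m (f : ℕ → ℕ) →
         ∑[ k ∈ upTo (suc m) ] ⟦ stepAt down k ≟ˢ down ⟧ * f k ≡ ∑[ i ∈ upTo (suc (m / 2)) ] f (2 * i)
∑-even zero f = cong (_+ 0) (+-identityʳ (f 0))
∑-even (suc zero) f = cong (_+ 0) (+-identityʳ (f 0))
∑-even (suc (suc m)) f = begin
  ∑[ k ∈ upTo (3 + m) ] ⟦ stepAt down k ≟ˢ down ⟧ * f k
    ≡⟨ ∑-upTo-suc (2 + m) (λ k → ⟦ stepAt down k ≟ˢ down ⟧ * f k) ⟩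
  1 * f 0 + ∑[ k ∈ upTo (2 + m) ] ⟦ stepAt down (suc k) ≟ˢ down ⟧ * f (suc k)
    ≡⟨ cong (1 * f 0 +_) (∑-upTo-suc (suc m) (λ k → ⟦ stepAt down (suc k) ≟ˢ down ⟧ * f (suc k))) ⟩
  1 * f 0 + (0 * f 1 + ∑[ k ∈ upTo (suc m) ] ⟦ stepAt down k ≟ˢ down ⟧ * f (2 + k))
    ≡⟨ cong₂ _+_ (*-identityˡ (f 0)) (∑-even m (λ k → f (2 + k))) ⟩
  f 0 + ∑[ i ∈ upTo (suc (m / 2)) ] f (2 + 2 * i)
    ≡⟨ cong (f 0 +_) (∑-cong (upTo (suc (m / 2))) (λ i → cong f (*-suc 2 i))) ⟨
  f 0 + ∑[ i ∈ upTo (suc (m / 2)) ] f (2 * suc i)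
    ≡⟨ ∑-upTo-suc (suc (m / 2)) (λ i → f (2 * i)) ⟨
  ∑[ i ∈ upTo (2 + m / 2) ] f (2 * i)
    ≡⟨ cong (λ j → ∑[ i ∈ upTo (suc j) ] f (2 * i)) ([2+n]/2≡1+n/2 m) ⟨
  ∑[ i ∈ upTo (suc ((2 + m) / 2)) ] f (2 * i) ∎

∑-odd : ∀ n (f : ℕ → ℕ) →
        ∑[ k ∈ upTo n ] ⟦ stepAt down k ≟ˢ up ⟧ * f k ≡ ∑[ i ∈ upTo (n / 2) ] f (1 + 2 * i)
∑-odd zero f = refl
∑-odd (suc zero) f = refl
∑-odd (suc (suc n)) f = begin
  ∑[ k ∈ upTo (2 + n) ] ⟦ stepAt down k ≟ˢ up ⟧ * f k
    ≡⟨ ∑-upTo-suc (suc n) (λ k → ⟦ stepAt down k ≟ˢ up ⟧ * f k) ⟩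
  0 * f 0 + ∑[ k ∈ upTo (suc n) ] ⟦ stepAt down (suc k) ≟ˢ up ⟧ * f (suc k)
    ≡⟨ cong (0 * f 0 +_) (∑-upTo-suc n (λ k → ⟦ stepAt down (suc k) ≟ˢ up ⟧ * f (suc k))) ⟩
  0 + (1 * f 1 + ∑[ k ∈ upTo n ] ⟦ stepAt down k ≟ˢ up ⟧ * f (2 + k))
    ≡⟨ cong₂ _+_ (*-identityˡ (f 1)) (∑-odd n (λ k → f (2 + k))) ⟩
  f 1 + ∑[ i ∈ upTo (n / 2) ] f (3 + 2 * i)
    ≡⟨ cong (f 1 +_) (∑-cong (upTo (n / 2)) (λ i → cong (f ∘ suc) (*-suc 2 i))) ⟨
  f 1 + ∑[ i ∈ upTo (n / 2) ] f (1 + 2 * suc i)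
    ≡⟨ ∑-upTo-suc (n / 2) (λ i → f (1 + 2 * i)) ⟨
  ∑[ i ∈ upTo (suc (n / 2)) ] f (1 + 2 * i)
    ≡⟨ cong (λ j → ∑[ i ∈ upTo j ] f (1 + 2 * i)) ([2+n]/2≡1+n/2 n) ⟨
  ∑[ i ∈ upTo ((2 + n) / 2) ] f (1 + 2 * i) ∎

-- Dispositions of the staircase

map-toList-allVecs : ∀ k m → map toList (allVecs k m) ≡ words m (allFin k)
map-toList-allVecs k zero = refl
map-toList-allVecs k (suc m) =
  trans (map-concatMap toList (λ x → map (x ∷ᵥ_) (allVecs k m)) (allFin k))
        (concatMap-cong (λ x → begin
          map toList (map (x ∷ᵥ_) (allVecs k m)) ≡⟨ map-∘ (allVecs k m) ⟨
          map ((x ∷_) ∘ toList) (allVecs k m)    ≡⟨ map-∘ (allVecs k m) ⟩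
          map (x ∷_) (map toList (allVecs k m))  ≡⟨ cong (map (x ∷_)) (map-toList-allVecs k m) ⟩
          map (x ∷_) (words m (allFin k))        ∎) (allFin k))

zigzag≤1 : ∀ d l → zigzag d l ≤ 1
zigzag≤1 d [] = ≤-refl
zigzag≤1 d (x ∷ []) = ≤-refl
zigzag≤1 d (x ∷ y ∷ l) = *-mono-≤ (⟦⟧≤1 (ordered? d x y)) (zigzag≤1 (opposite d) (y ∷ l))

zigzag≡1⇔alternating : (f : A → ℕ) → ∀ {k} d (u : Vec A (suc k)) →
                       zigzag d (map f (toList u)) ≡ 1 ⇔
                       (∀ (i : Fin k) → Ordered (stepAt d (toℕ i)) (f (Vec.lookup u (inject₁ i)))
                                                                   (f (Vec.lookup u (fsuc i))))
zigzag≡1⇔alternating f {zero} d (x ∷ᵥ []ᵥ) = mk⇔ (λ _ ()) (λ _ → refl)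
zigzag≡1⇔alternating f {suc k} d (x ∷ᵥ u@(y ∷ᵥ _)) = mk⇔
  (λ z≡1 → λ where
    fzero → ⟦⟧≡1⇒ (ordered? d _ _) (m*n≡1⇒m≡1 _ _ z≡1)
    (fsuc i) → Equivalence.to (zigzag≡1⇔alternating f (opposite d) u)
                               (m*n≡1⇒n≡1 ⟦ ordered? d (f x) (f y) ⟧ _ z≡1) i)
  (λ adjacent → cong₂ _*_ (⟦⟧-yes (ordered? d _ _) (adjacent fzero))
                          (Equivalence.from (zigzag≡1⇔alternating f (opposite d) u) (adjacent ∘ fsuc)))

isEven⇔descent : ∀ i → T (isEven i) ⇔ stepAt down i ≡ down
isEven⇔descent zero = mk⇔ (λ _ → refl) (λ _ → _)
isEven⇔descent (suc zero) = mk⇔ (λ ()) (λ ())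
isEven⇔descent (suc (suc i)) = isEven⇔descent i

descent-suc : ∀ i → stepAt down (suc i) ≡ down ⇔ stepAt down i ≡ up
descent-suc i rewrite stepAt-suc down i with stepAt down i
... | down = mk⇔ (λ ()) (λ ())
... | up = mk⇔ (λ _ → refl) (λ _ → refl)

stairArc⇔ : ∀ {n} (a b : Fin n) →
            T (stairArc a b) ⇔ (T (isEven (toℕ a)) × (toℕ b ≡ suc (toℕ a) ⊎ suc (toℕ b) ≡ toℕ a))
stairArc⇔ a b = mk⇔
  (λ isArc → let (even , adjacent) = Equivalence.to T-∧ isArc in
     even , Data.Sum.map (≡ᵇ⇒≡ _ _) (≡ᵇ⇒≡ _ _) (Equivalence.to T-∨ adjacent))
  (λ (even , adjacent) →
     Equivalence.from T-∧ (even , Equivalence.from T-∨ (Data.Sum.map (≡⇒≡ᵇ _ _) (≡⇒≡ᵇ _ _) adjacent)))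

-- The arcs of 𝔖ₖ₊₁ with 0-based indices: from i to i+1 if i is even, from i+1 to i if i is odd.
data StairArc {k : ℕ} : Fin (suc k) → Fin (suc k) → Set where
  descending : ∀ i → stepAt down (toℕ i) ≡ down → StairArc (inject₁ i) (fsuc i)
  ascending  : ∀ i → stepAt down (toℕ i) ≡ up → StairArc (fsuc i) (inject₁ i)

stairArc⇔StairArc : ∀ {k} (a b : Fin (suc k)) → T (stairArc a b) ⇔ StairArc a b
stairArc⇔StairArc a b = mk⇔ (view a b) adjacency ⇔-∘ stairArc⇔ a b
  where
  adjacency : ∀ {a b} → StairArc a b → T (isEven (toℕ a)) × (toℕ b ≡ suc (toℕ a) ⊎ suc (toℕ b) ≡ toℕ a)
  adjacency (descending i descent) =
    Equivalence.from (isEven⇔descent (toℕ (inject₁ i))) (trans (cong (stepAt down) (toℕ-inject₁ i)) descent) ,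
    inj₁ (cong suc (sym (toℕ-inject₁ i)))
  adjacency (ascending i ascent) =
    Equivalence.from (isEven⇔descent (suc (toℕ i))) (Equivalence.from (descent-suc (toℕ i)) ascent) ,
    inj₂ (cong suc (toℕ-inject₁ i))
  view : ∀ a b → T (isEven (toℕ a)) × (toℕ b ≡ suc (toℕ a) ⊎ suc (toℕ b) ≡ toℕ a) → StairArc a b
  view a (fsuc i) (even , inj₁ 1+i≡1+a)
    with toℕ-injective {i = a} {j = inject₁ i} (trans (suc-injective (sym 1+i≡1+a)) (sym (toℕ-inject₁ i)))
  ... | refl = descending i
                 (trans (cong (stepAt down) (sym (toℕ-inject₁ i)))
                        (Equivalence.to (isEven⇔descent (toℕ a)) even))
  view (fsuc i) b (even , inj₂ 1+b≡1+i)
    with toℕ-injective {i = b} {j = inject₁ i} (trans (suc-injective 1+b≡1+i) (sym (toℕ-inject₁ i)))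
  ... | refl = ascending i
                 (Equivalence.to (descent-suc (toℕ i)) (Equivalence.to (isEven⇔descent (toℕ (fsuc i))) even))

arcsRespected⇔alternating : ∀ {k} (v : Vec (Fin (suc k)) (suc k)) →
                            ArcsRespected (Staircase (suc k)) v ⇔
                            (∀ (i : Fin k) → Ordered (stepAt down (toℕ i)) (toℕ (Vec.lookup v (inject₁ i)))
                                                                           (toℕ (Vec.lookup v (fsuc i))))
arcsRespected⇔alternating {k} v = mk⇔ arcs⇒step
  (λ alternating → tabulate⁺ {f = id} λ a → tabulate⁺ {f = id} λ b isArc →
     StairArc⇒< alternating (Equivalence.to (stairArc⇔StairArc a b) isArc))
  where
  V : Fin (suc k) → ℕ
  V a = toℕ (Vec.lookup v a)
  arcs⇒step : ArcsRespected (Staircase (suc k)) v →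
              ∀ i → Ordered (stepAt down (toℕ i)) (V (inject₁ i)) (V (fsuc i))
  arcs⇒step arcs i with stepAt down (toℕ i) in step
  ... | down = tabulate⁻ {f = id} (tabulate⁻ {f = id} arcs (inject₁ i)) (fsuc i)
                 (Equivalence.from (stairArc⇔StairArc _ _) (descending i step))
  ... | up = tabulate⁻ {f = id} (tabulate⁻ {f = id} arcs (fsuc i)) (inject₁ i)
               (Equivalence.from (stairArc⇔StairArc _ _) (ascending i step))
  StairArc⇒< : (∀ i → Ordered (stepAt down (toℕ i)) (V (inject₁ i)) (V (fsuc i))) →
               ∀ {a b} → StairArc a b → V b < V a
  StairArc⇒< alternating (descending i descent) = subst (λ e → Ordered e (V (inject₁ i)) (V (fsuc i))) descent
                                                        (alternating i)
  StairArc⇒< alternating (ascending i ascent) = subst (λ e → Ordered e (V (inject₁ i)) (V (fsuc i))) ascent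
                                                      (alternating i)

⟦arcsRespected?⟧ : ∀ n (v : Vec (Fin n) n) →
                   ⟦ arcsRespected? (Staircase n) v ⟧ ≡ zigzag down (map toℕ (toList v))
⟦arcsRespected?⟧ zero []ᵥ = refl
⟦arcsRespected?⟧ (suc k) v =
  ⟦⟧-unique (arcsRespected? (Staircase (suc k)) v) (zigzag≤1 down (map toℕ (toList v)))
            (⇔-sym (zigzag≡1⇔alternating toℕ down v) ⇔-∘ arcsRespected⇔alternating v)

s≡zigzags : ∀ n → s n ≡ zigzags down n
s≡zigzags n = begin
  length (filter (isDisposition? (Staircase n)) (allVecs n n))
    ≡⟨ length-filter (isDisposition? (Staircase n)) (allVecs n n) ⟩
  ∑[ v ∈ allVecs n n ] ⟦ isDisposition? (Staircase n) v ⟧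
    ≡⟨ ∑-cong (allVecs n n) (λ v → trans (⟦⟧-×-dec (unique? (toList v)) (arcsRespected? (Staircase n) v))
                                         (cong (⟦ unique? (toList v) ⟧ *_) (⟦arcsRespected?⟧ n v))) ⟩
  ∑[ v ∈ allVecs n n ] ⟦ unique? (toList v) ⟧ * zigzag down (map toℕ (toList v))
    ≡⟨ ∑-map toList (allVecs n n) (λ w → ⟦ unique? w ⟧ * zigzag down (map toℕ w)) ⟨
  ∑[ w ∈ map toList (allVecs n n) ] ⟦ unique? w ⟧ * zigzag down (map toℕ w)
    ≡⟨ cong (λ ws → ∑[ w ∈ ws ] ⟦ unique? w ⟧ * zigzag down (map toℕ w)) (map-toList-allVecs n n) ⟩
  ∑[ w ∈ words n (allFin n) ] ⟦ unique? w ⟧ * zigzag down (map toℕ w)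
    ≡⟨ ∑-words-unique _≟ᶠ_ (Unique.allFin⁺ n) n (zigzag down ∘ map toℕ) ⟩
  sumPerms n (allFin n) (zigzag down ∘ map toℕ)
    ≡⟨ sumPerms-map toℕ n (allFin n) (zigzag down) ⟨
  sumPerms n (map toℕ (allFin n)) (zigzag down)
    ≡⟨ cong (λ S → sumPerms n S (zigzag down)) (map-toℕ-allFin n) ⟩
  zigzags down n ∎
  where open UniqueDec (_≟ᶠ_ {n}) using (unique?)

binomialTerm-s≡zigzags : ∀ m k → (m C k) * s k * s (m ∸ k) ≡ (m C k) * (zigzags down k * zigzags down (m ∸ k))
binomialTerm-s≡zigzags m k =
  trans (*-assoc (m C k) (s k) _) (cong₂ (λ a b → (m C k) * (a * b)) (s≡zigzags k) (s≡zigzags (m ∸ k)))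

s≡sumB : (n : ℕ) → 1 ≤ n → s n ≡ sumB n
s≡sumB (suc m) _ = begin
  s (suc m)
    ≡⟨ s≡zigzags (suc m) ⟩
  zigzags down (suc m)
    ≡⟨ zigzags-peak m ⟩
  ∑[ k ∈ upTo (suc m) ] ⟦ stepAt down k ≟ˢ down ⟧ * ((m C k) * (zigzags down k * zigzags down (m ∸ k)))
    ≡⟨ ∑-even m (λ k → (m C k) * (zigzags down k * zigzags down (m ∸ k))) ⟩
  ∑[ i ∈ upTo (suc (m / 2)) ] (m C (2 * i)) * (zigzags down (2 * i) * zigzags down (m ∸ 2 * i))
    ≡⟨ ∑-cong (upTo (suc (m / 2))) (λ i → trans (cong (λ b → (m C (2 * i)) * s (2 * i) * s b) (1+m∸2i∸1≡m∸2i i))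
                                               (binomialTerm-s≡zigzags m (2 * i))) ⟨
  sumB (suc m) ∎
  where
  1+m∸2i∸1≡m∸2i : ∀ i → suc m ∸ 2 * i ∸ 1 ≡ m ∸ 2 * i
  1+m∸2i∸1≡m∸2i i = trans (∸-+-assoc (suc m) (2 * i) 1) (cong (suc m ∸_) (+-comm (2 * i) 1))

s≡sumA : (n : ℕ) → 2 ≤ n → s n ≡ sumA n
s≡sumA (suc zero) (s≤s ())
s≡sumA (suc (suc m′)) _ = begin
  s (suc m)
    ≡⟨ s≡zigzags (suc m) ⟩
  zigzags down (suc m)
    ≡⟨ zigzags-valley m (s≤s z≤n) ⟩
  ∑[ k ∈ upTo (suc m) ] ⟦ stepAt down k ≟ˢ up ⟧ * ((m C k) * (zigzags down k * zigzags down (m ∸ k)))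
    ≡⟨ ∑-odd (suc m) (λ k → (m C k) * (zigzags down k * zigzags down (m ∸ k))) ⟩
  ∑[ i ∈ upTo (suc m / 2) ] (m C (1 + 2 * i)) * (zigzags down (1 + 2 * i) * zigzags down (m ∸ (1 + 2 * i)))
    ≡⟨ ∑-cong (upTo (suc m / 2)) (λ i →
         trans (cong (λ a → (m C (a ∸ 1)) * s (a ∸ 1) * s (suc m ∸ a)) (*-suc 2 i))
               (binomialTerm-s≡zigzags m (1 + 2 * i))) ⟨
  sumA (suc m) ∎
  where
  m : ℕ
  m = suc m′

mainTheorem4 : ((n : ℕ) → 2 ≤ n → s n ≡ sumA n)
    × ((n : ℕ) → 1 ≤ n → s n ≡ sumB n)
mainTheorem4 = s≡sumA , s≡sumB
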